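{- Let $H$ be a connected graph with at least one edge or loop. Then the corona $H\circ K_1$ is a DTDP-graph. Moreover, $H\circ K_1$ is a minimal DTDP-graph if and only if $H$ is a star $K_{1,n}$ ($n\ge1$) or $H=C_1$.
   Context: Graphs may have multiple edges and multiple loops; $C_1$ denotes the graph with one vertex and one loop. The corona $H\circ K_1$ is obtained from $H$ by adding, for each vertex $v$ of $H$, a new vertex $v'$ and the edge $vv'$. For a vertex $v$, $N_G(v)$ is the set of vertices adjacent to $v$ (a vertex with a loop is its own neighbour). A set $D\subseteq V_G$ is dominating if every vertex not in $D$ has a neighbour in $D$; $T\subseteq V_G$ is total dominating if every vertex of $G$ (including those in $T$) has a neighbour in $T$. A DT-pair is a pair $(D,T)$ of disjoint vertex sets with $D$ dominating and $T$ total dominating; $G$ is a DTDP-graph if it has a DT-pair. A connected graph $G$ is a minimal DTDP-graph if it is a DTDP-graph and no proper spanning subgraph of $G$ (same vertex set, proper subset of the edges and loops) is a DTDP-graph. -}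

module Defs where

open import Data.Nat using (ℕ; zero; suc; _+_; _≤_; _<_)
open import Data.Fin using (Fin; zero; suc; _↑ˡ_; _↑ʳ_)
open import Data.Fin.Properties using () renaming (_≟_ to _≟ᶠ_)
open import Data.Fin.Subset using (Subset; _∈_; _∉_)
open import Data.List using (List; []; _∷_; map; _++_; length; filter; allFin)
open import Data.List.Membership.Propositional using () renaming (_∈_ to _∈ˡ_)
open import Data.List.Relation.Binary.Sublist.Propositional using () renaming (_⊆_ to _⊑_)
open import Data.Product using (Σ; _×_; _,_; ∃; ∃-syntax)
open import Data.Product.Properties using (≡-dec)
open import Data.Sum using (_⊎_)
open import Function.Bundles using (_↔_; Inverse)
open import Relation.Nullary using (¬_)
open import Relation.Nullary.Decidable using (_⊎-dec_)
open import Relation.Binary.PropositionalEquality using (_≡_)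

-- A finite multigraph with loops: vertices Fin n, edges a list (multiset)
-- of unordered pairs, each stored as an ordered pair; a loop at v is (v , v).
record Graph : Set where
  constructor mkGraph
  field
    n     : ℕ
    edges : List (Fin n × Fin n)
open Graph public

Vertex : Graph → Set
Vertex G = Fin (n G)

-- u and v are adjacent (a vertex with a loop is its own neighbour)
Adj : (G : Graph) → Vertex G → Vertex G → Set
Adj G u v = ((u , v) ∈ˡ edges G) ⊎ ((v , u) ∈ˡ edges G)

data Reach (G : Graph) : Vertex G → Vertex G → Set where
  here : ∀ {u} → Reach G u u
  step : ∀ {u v w} → Adj G u v → Reach G v w → Reach G u w

Connected : Graph → Set
Connected G = ∀ (u v : Vertex G) → Reach G u v

Dominating : (G : Graph) → Subset (n G) → Set
Dominating G D = ∀ v → v ∉ D → ∃[ u ] (u ∈ D × Adj G v u)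

TotalDominating : (G : Graph) → Subset (n G) → Set
TotalDominating G T = ∀ v → ∃[ u ] (u ∈ T × Adj G v u)

Disjoint : ∀ {k} → Subset k → Subset k → Set
Disjoint D T = ∀ v → v ∈ D → v ∉ T

DTPair : (G : Graph) → Subset (n G) → Subset (n G) → Set
DTPair G D T = Disjoint D T × Dominating G D × TotalDominating G T

DTDP : Graph → Set
DTDP G = ∃[ D ] ∃[ T ] DTPair G D T

ProperSpanningSubgraph : (G' G : Graph) → Set
ProperSpanningSubgraph G' G =
  Σ (n G' ≡ n G) λ { _≡_.refl → (edges G' ⊑ edges G) × (length (edges G') < length (edges G)) }

MinimalDTDP : Graph → Set
MinimalDTDP G = Connected G × DTDP G ×
  (∀ G' → ProperSpanningSubgraph G' G → ¬ DTDP G')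

-- corona H ∘ K₁ : vertices v ↦ v ↑ˡ n, pendant v' ↦ n ↑ʳ v
corona : Graph → Graph
corona H = mkGraph (n H + n H)
  (map (λ { (u , v) → (u ↑ˡ n H , v ↑ˡ n H) }) (edges H)
   ++ map (λ v → (v ↑ˡ n H , n H ↑ʳ v)) (allFin (n H)))

-- number of edges joining u and v (loops at v counted once for u = v)
mult : (G : Graph) → Vertex G → Vertex G → ℕ
mult G u v = length (filter (λ e → ≡-dec _≟ᶠ_ _≟ᶠ_ e (u , v) ⊎-dec ≡-dec _≟ᶠ_ _≟ᶠ_ e (v , u)) (edges G))

Isomorphic : Graph → Graph → Set
Isomorphic G K = Σ (Vertex G ↔ Vertex K) λ σ →
  ∀ u v → mult G u v ≡ mult K (Inverse.to σ u) (Inverse.to σ v)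

Star : ℕ → Graph
Star k = mkGraph (suc k) (map (λ i → (zero , suc i)) (allFin k))

C₁ : Graph
C₁ = mkGraph 1 ((zero , zero) ∷ [])

-- The corona H ∘ K₁ always has the DT-pair (pendant vertices, vertices of H), since H has no
-- isolated vertex. A DT-pair cannot exist if some vertex is isolated, nor if some component is
-- a single edge uv: total domination forces u, v ∈ T, and then nothing in D dominates u.
-- Deleting a spoke vv' of the corona isolates v'; deleting an edge uv of H whose end v is a leaf
-- leaves vv' as a component. As DT-pairs survive adding edges, the corona is therefore minimal
-- when every edge of H has a leaf end.
-- Conversely, if both ends of an edge of H have degree at least 2, deleting it from H leaves no
-- isolated vertex, and the corona of the smaller graph is a DTDP proper spanning subgraph.
-- Finally, a connected graph in which every edge has a leaf end is a star or C₁.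
module Submission where

open import Defs
open import Level using (0ℓ)
open import Function.Base using (_∘_)
open import Function.Bundles using (_⇔_; mk⇔; _↔_; Inverse; Injection; mk↔ₛ′)
open import Function.Properties.Inverse using (↔⇒↣)
open import Data.Bool using (true; false)
open import Data.Empty using (⊥; ⊥-elim)
open import Data.Nat using (ℕ; zero; suc; _+_; _≤_; _<_; z≤n; s≤s; s≤s⁻¹) renaming (_≟_ to _≟ℕ_)
open import Data.Nat.Properties
  using (≤-refl; ≤-trans; ≤-antisym; +-suc; +-identityʳ; m≤n⇒m≤1+n; n≤0⇒n≡0; n≢0⇒n>0; n≮0)
  renaming (suc-injective to ℕ-suc-injective)
open import Data.Fin using (Fin; zero; suc; _↑ˡ_; _↑ʳ_; splitAt)
open import Data.Fin.Properties
  using (suc-injective; ↑ˡ-injective; ↑ʳ-injective; splitAt-↑ˡ; splitAt-↑ʳ; splitAt⁻¹-↑ˡ; splitAt⁻¹-↑ʳ)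
  renaming (_≟_ to _≟ᶠ_)
open import Data.Fin.Subset using (Subset; _∈_; ∁)
open import Data.Fin.Subset.Properties using (_∈?_; x∈∁p⇒x∉p; x∉p⇒x∈∁p)
open import Data.Fin.Permutation using (transpose)
open import Data.Vec using (replicate) renaming (_++_ to _++ᵛ_)
open import Data.Vec.Properties using (lookup-++ˡ; lookup-++ʳ; lookup-replicate; lookup⇒[]=; []=⇒lookup)
open import Data.List using (List; []; _∷_; map; _++_; length; filter; allFin; tabulate)
open import Data.List.Properties
  using (length-++; filter-++; filter-≐; filter-none; filter-some; filter-accept; filter-reject)
open import Data.List.Membership.Propositional using (lose) renaming (_∈_ to _∈ˡ_)
open import Data.List.Membership.Propositional.Properties
  using (∈-++⁺ˡ; ∈-++⁺ʳ; ∈-++⁻; ∈-map⁺; ∈-map⁻; ∈-allFin; ∈-tabulate⁻; ∈-filter⁻; ∈-∃++)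
import Data.List.Relation.Unary.All as All
open import Data.List.Relation.Unary.Any using (here)
open import Data.List.Relation.Binary.Sublist.Heterogeneous using (_∷_; _∷ʳ_)
open import Data.List.Relation.Binary.Sublist.Propositional using (⊆-refl) renaming (_⊆_ to _⊑_)
open import Data.List.Relation.Binary.Sublist.Propositional.Properties using (Any-resp-⊆; filter⁺; length-mono-≤)
open import Data.Product using (_×_; _,_; proj₁; proj₂; ∃-syntax; ∃₂; map₂)
open import Data.Product.Properties using (≡-dec)
open import Data.Sum using (_⊎_; inj₁; inj₂; swap; reduce)
import Data.Sum as Sum
open import Relation.Nullary using (¬_; Dec; yes; no)
open import Relation.Nullary.Decidable using (_⊎-dec_)
open import Relation.Unary using (Pred; Decidable; _≐_)
open import Relation.Binary.PropositionalEquality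

-- Counting in lists

module _ {A : Set} {P : Pred A 0ℓ} (P? : Decidable P) where

  count : List A → ℕ
  count xs = length (filter P? xs)

  count-++ : ∀ xs ys → count (xs ++ ys) ≡ count xs + count ys
  count-++ xs ys = trans (cong length (filter-++ P? xs ys)) (length-++ (filter P? xs))

  count-none : ∀ xs → (∀ {x} → x ∈ˡ xs → ¬ P x) → count xs ≡ 0
  count-none _ ¬P = cong length (filter-none P? (All.tabulate ¬P))

  count-pos : ∀ {x xs} → x ∈ˡ xs → P x → 0 < count xs
  count-pos x∈xs px = filter-some P? (lose x∈xs px)

  count-pos⁻ : ∀ xs → 0 < count xs → ∃[ x ] x ∈ˡ xs × P x
  count-pos⁻ xs pos with filter P? xs in eq | pos
  ... | x ∷ _ | _ = x , ∈-filter⁻ P? (subst (x ∈ˡ_) (sym eq) (here refl))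
  ... | []    | ()

  count-delete : ∀ pre {e} post → P e → count (pre ++ e ∷ post) ≡ suc (count (pre ++ post))
  count-delete pre {e} post pe = begin
    count (pre ++ e ∷ post)       ≡⟨ count-++ pre (e ∷ post) ⟩
    count pre + count (e ∷ post)  ≡⟨ cong (λ ys → count pre + length ys) (filter-accept P? pe) ⟩
    count pre + suc (count post)  ≡⟨ +-suc (count pre) (count post) ⟩
    suc (count pre + count post)  ≡⟨ cong suc (count-++ pre post) ⟨
    suc (count (pre ++ post))     ∎
    where open ≡-Reasoning

  count-delete-rejected : ∀ pre {e} post → ¬ P e → count (pre ++ e ∷ post) ≡ count (pre ++ post)
  count-delete-rejected pre {e} post ¬pe = begin
    count (pre ++ e ∷ post)       ≡⟨ count-++ pre (e ∷ post) ⟩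
    count pre + count (e ∷ post)  ≡⟨ cong (λ ys → count pre + length ys) (filter-reject P? ¬pe) ⟩
    count pre + count post        ≡⟨ count-++ pre post ⟨
    count (pre ++ post)           ∎
    where open ≡-Reasoning

  count-tabulate-unique : ∀ {n} (f : Fin n → A) {j} → P (f j) → (∀ {i} → P (f i) → i ≡ j) →
                          count (tabulate f) ≡ 1
  count-tabulate-unique f {zero} pj unique =
    trans (cong length (filter-accept P? pj)) (cong suc (count-none _ none))
    where
      none : ∀ {x} → x ∈ˡ tabulate (f ∘ suc) → ¬ P x
      none x∈ px with ∈-tabulate⁻ x∈
      ... | i , refl with unique px
      ...   | ()
  count-tabulate-unique f {suc j} pj unique with P? (f zero)
  ... | yes p₀ with unique p₀
  ...   | ()
  count-tabulate-unique f {suc j} pj unique | no _ =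
    count-tabulate-unique (f ∘ suc) pj (suc-injective ∘ unique)

count-map : ∀ {A B : Set} {P : Pred B 0ℓ} (P? : Decidable P) (f : A → B) xs →
            count P? (map f xs) ≡ count (P? ∘ f) xs
count-map P? f [] = refl
count-map P? f (x ∷ xs) with P? (f x)
... | yes _ = cong suc (count-map P? f xs)
... | no _  = count-map P? f xs

module _ {A : Set} {P Q : Pred A 0ℓ} (P? : Decidable P) (Q? : Decidable Q) where

  count-mono : ∀ {xs ys} → (∀ {x} → P x → Q x) → xs ⊑ ys → count P? xs ≤ count Q? ys
  count-mono P⇒Q xs⊑ys = length-mono-≤ (filter⁺ P? Q? (λ { refl → P⇒Q }) xs⊑ys)

  count-≐ : P ≐ Q → ∀ xs → count P? xs ≡ count Q? xs
  count-≐ P≐Q xs = cong length (filter-≐ P? Q? P≐Q xs)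

  count-disjoint-≤ : ∀ {R : Pred A 0ℓ} (R? : Decidable R) →
                     (∀ {x} → P x → Q x → ⊥) → (∀ {x} → P x → R x) → (∀ {x} → Q x → R x) →
                     ∀ xs → count P? xs + count Q? xs ≤ count R? xs
  count-disjoint-≤ R? P#Q P⇒R Q⇒R [] = z≤n
  count-disjoint-≤ R? P#Q P⇒R Q⇒R (x ∷ xs)
    with ih ← count-disjoint-≤ R? P#Q P⇒R Q⇒R xs | P? x | Q? x | R? x
  ... | yes p | yes q | _     = ⊥-elim (P#Q p q)
  ... | yes p | no _  | no ¬r = ⊥-elim (¬r (P⇒R p))
  ... | no _  | yes q | no ¬r = ⊥-elim (¬r (Q⇒R q))
  ... | yes _ | no _  | yes _ = s≤s ih
  ... | no _  | yes _ | yes _ = subst (_≤ suc (count R? xs)) (sym (+-suc _ _)) (s≤s ih)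
  ... | no _  | no _  | yes _ = m≤n⇒m≤1+n ih
  ... | no _  | no _  | no _  = ih

module _ {A : Set} where

  deletion-⊑ : ∀ pre {e : A} post → pre ++ post ⊑ pre ++ e ∷ post
  deletion-⊑ []        post = _ ∷ʳ ⊆-refl
  deletion-⊑ (x ∷ pre) post = refl ∷ deletion-⊑ pre post

  shorter-sublist⇒deletion : ∀ {xs ys : List A} → xs ⊑ ys → length xs < length ys →
                             ∃[ pre ] ∃[ e ] ∃[ post ] (ys ≡ pre ++ e ∷ post × xs ⊑ pre ++ post)
  shorter-sublist⇒deletion (y ∷ʳ xs⊑ys) _ = [] , y , _ , refl , xs⊑ys
  shorter-sublist⇒deletion (refl ∷ xs⊑ys) (s≤s shorter) with shorter-sublist⇒deletion xs⊑ys shorter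
  ... | pre , e , post , refl , xs⊑ = _ ∷ pre , e , post , refl , refl ∷ xs⊑

map-deletion-⊏ : ∀ {A B : Set} (f : A → B) pre {e} post zs →
                 (map f (pre ++ post) ++ zs ⊑ map f (pre ++ e ∷ post) ++ zs) ×
                 (length (map f (pre ++ post) ++ zs) < length (map f (pre ++ e ∷ post) ++ zs))
map-deletion-⊏ f []        post zs = _ ∷ʳ ⊆-refl , ≤-refl
map-deletion-⊏ f (x ∷ pre) post zs =
  let sub , shorter = map-deletion-⊏ f pre post zs in refl ∷ sub , s≤s shorter

-- Degrees, leaves and walks

Edge : ℕ → Set
Edge N = Fin N × Fin N

module _ {N : ℕ} where

  Joins : Fin N → Fin N → Pred (Edge N) 0ℓ
  Joins u v e = e ≡ (u , v) ⊎ e ≡ (v , u)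

  joins? : ∀ u v → Decidable (Joins u v)
  joins? u v e = ≡-dec _≟ᶠ_ _≟ᶠ_ e (u , v) ⊎-dec ≡-dec _≟ᶠ_ _≟ᶠ_ e (v , u)

  Incident : Fin N → Pred (Edge N) 0ℓ
  Incident v e = proj₁ e ≡ v ⊎ proj₂ e ≡ v

  incident? : ∀ v → Decidable (Incident v)
  incident? v e = (proj₁ e ≟ᶠ v) ⊎-dec (proj₂ e ≟ᶠ v)

degree : (G : Graph) → Vertex G → ℕ
degree G v = count (incident? v) (edges G)

NoIsolated : Graph → Set
NoIsolated G = ∀ v → ∃[ w ] Adj G v w

-- For v = a: a single loop at v and no other edge.
Leaf : (G : Graph) → Vertex G → Vertex G → Set
Leaf G v a = (∀ x → x ≢ a → mult G v x ≡ 0) × mult G v a ≡ 1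

EveryEdgePendant : Graph → Set
EveryEdgePendant G = ∀ {a b} → Adj G a b → Leaf G a b ⊎ Leaf G b a

module _ {G : Graph} where

  Adj-sym : ∀ {u v} → Adj G u v → Adj G v u
  Adj-sym = swap

  Adj⇒mult-pos : ∀ {u v} → Adj G u v → 0 < mult G u v
  Adj⇒mult-pos {u} {v} (inj₁ uv∈) = count-pos (joins? u v) uv∈ (inj₁ refl)
  Adj⇒mult-pos {u} {v} (inj₂ vu∈) = count-pos (joins? u v) vu∈ (inj₂ refl)

  mult-pos⇒Adj : ∀ {u v} → 0 < mult G u v → Adj G u v
  mult-pos⇒Adj {u} {v} pos with count-pos⁻ (joins? u v) (edges G) pos
  ... | _ , e∈ , inj₁ refl = inj₁ e∈
  ... | _ , e∈ , inj₂ refl = inj₂ e∈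

  mult-zero⇒¬Adj : ∀ {u v} → mult G u v ≡ 0 → ¬ Adj G u v
  mult-zero⇒¬Adj none adj = n≮0 (subst (0 <_) none (Adj⇒mult-pos adj))

  mult-sym : ∀ u v → mult G u v ≡ mult G v u
  mult-sym u v = count-≐ (joins? u v) (joins? v u) (swap , swap) (edges G)

  mult≤degree : ∀ v w → mult G v w ≤ degree G v
  mult≤degree v w = count-mono (joins? v w) (incident? v) {edges G}
                                (λ { (inj₁ refl) → inj₁ refl ; (inj₂ refl) → inj₂ refl }) ⊆-refl

  mult+mult≤degree : ∀ v {a w} → a ≢ w → mult G v a + mult G v w ≤ degree G v
  mult+mult≤degree v {a} {w} a≢w =
    count-disjoint-≤ (joins? v a) (joins? v w) (incident? v) disjoint incident incident (edges G)
    where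
      disjoint : ∀ {e} → Joins v a e → Joins v w e → ⊥
      disjoint (inj₁ refl) (inj₁ refl) = a≢w refl
      disjoint (inj₁ refl) (inj₂ refl) = a≢w refl
      disjoint (inj₂ refl) (inj₁ refl) = a≢w refl
      disjoint (inj₂ refl) (inj₂ refl) = a≢w refl
      incident : ∀ {x e} → Joins v x e → Incident v e
      incident (inj₁ refl) = inj₁ refl
      incident (inj₂ refl) = inj₂ refl

  Adj⇒degree-pos : ∀ {v w} → Adj G v w → 0 < degree G v
  Adj⇒degree-pos adj = ≤-trans (Adj⇒mult-pos adj) (mult≤degree _ _)

  degree-pos⇒Adj : ∀ {v} → 0 < degree G v → ∃[ w ] Adj G v w
  degree-pos⇒Adj {v} pos with count-pos⁻ (incident? v) (edges G) pos
  ... | (_ , b) , e∈ , inj₁ refl = b , inj₁ e∈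
  ... | (a , _) , e∈ , inj₂ refl = a , inj₂ e∈

  Leaf⇒Adj : ∀ {v a} → Leaf G v a → Adj G v a
  Leaf⇒Adj (_ , one) = mult-pos⇒Adj (subst (0 <_) (sym one) (s≤s z≤n))

  Leaf-unique-neighbour : ∀ {v a w} → Leaf G v a → Adj G v w → w ≡ a
  Leaf-unique-neighbour {a = a} {w} (elsewhere , _) adj with w ≟ᶠ a
  ... | yes w≡a = w≡a
  ... | no w≢a  = ⊥-elim (mult-zero⇒¬Adj (elsewhere w w≢a) adj)

  degree-one⇒Leaf : ∀ {v a} → degree G v ≡ 1 → Adj G v a → Leaf G v a
  degree-one⇒Leaf {v} {a} degree₁ adj = elsewhere , one
    where
      one : mult G v a ≡ 1
      one = ≤-antisym (subst (mult G v a ≤_) degree₁ (mult≤degree v a)) (Adj⇒mult-pos adj)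
      elsewhere : ∀ x → x ≢ a → mult G v x ≡ 0
      elsewhere x x≢a = n≤0⇒n≡0 (s≤s⁻¹ (subst₂ _≤_ (cong (_+ mult G v x) one) degree₁
                                                   (mult+mult≤degree v (x≢a ∘ sym))))

module _ {G : Graph} where

  Reach-trans : ∀ {u v w} → Reach G u v → Reach G v w → Reach G u w
  Reach-trans here         r′ = r′
  Reach-trans (step adj r) r′ = step adj (Reach-trans r r′)

  Reach-invariant : (P : Vertex G → Set) → (∀ {u w} → P u → Adj G u w → P w) →
                    ∀ {u v} → P u → Reach G u v → P v
  Reach-invariant P closed pu here         = pu
  Reach-invariant P closed pu (step adj r) = Reach-invariant P closed (closed pu adj) r

Reach-map : ∀ {G G′} (f : Vertex G → Vertex G′) → (∀ {u v} → Adj G u v → Adj G′ (f u) (f v)) →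
            ∀ {u v} → Reach G u v → Reach G′ (f u) (f v)
Reach-map f f-adj here         = here
Reach-map f f-adj (step adj r) = step (f-adj adj) (Reach-map f f-adj r)

connected⇒NoIsolated : ∀ G → Connected G → 0 < length (edges G) → NoIsolated G
connected⇒NoIsolated (mkGraph N ((a , b) ∷ _)) connected _ v with connected v a
... | here       = b , inj₁ (here refl)
... | step adj _ = _ , adj

-- DT-pairs

NoProperSpanningDTDP : Graph → Set
NoProperSpanningDTDP G = ∀ G′ → ProperSpanningSubgraph G′ G → ¬ DTDP G′

module _ {N : ℕ} {es es′ : List (Edge N)} (es⊆es′ : ∀ {e} → e ∈ˡ es → e ∈ˡ es′) where

  Adj-⊆ : ∀ {u v} → Adj (mkGraph N es) u v → Adj (mkGraph N es′) u v
  Adj-⊆ = Sum.map es⊆es′ es⊆es′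

  DTDP-⊆ : DTDP (mkGraph N es) → DTDP (mkGraph N es′)
  DTDP-⊆ (D , T , disjoint , dominating , total) =
    D , T , disjoint , (λ v v∉D → map₂ (map₂ Adj-⊆) (dominating v v∉D)) ,
    (λ v → map₂ (map₂ Adj-⊆) (total v))

isolated-vertex⇒¬DTDP : ∀ {G v} → (∀ {w} → ¬ Adj G v w) → ¬ DTDP G
isolated-vertex⇒¬DTDP {v = v} isolated (_ , _ , _ , _ , total) = isolated (proj₂ (proj₂ (total v)))

isolated-edge⇒¬DTDP : ∀ {G u v} → (∀ {w} → Adj G u w → w ≡ v) → (∀ {w} → Adj G v w → w ≡ u) →
                      ¬ DTDP G
isolated-edge⇒¬DTDP {G} {u} {v} onlyᵤ onlyᵥ (D , T , disjoint , dominating , total) = decide (u ∈? D)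
  where
    in-T : ∀ {x y} → (∀ {w} → Adj G x w → w ≡ y) → y ∈ T
    in-T {x} only = let w , w∈T , adj = total x in subst (_∈ T) (only adj) w∈T
    decide : Dec (u ∈ D) → ⊥
    decide (yes u∈D) = disjoint u u∈D (in-T onlyᵥ)
    decide (no u∉D)  = let w , w∈D , adj = dominating u u∉D in
                       disjoint v (subst (_∈ D) (onlyᵤ adj) w∈D) (in-T onlyᵤ)

module _ {N : ℕ} {es pre post : List (Edge N)} {e : Edge N} (es≡ : es ≡ pre ++ e ∷ post) where

  Adj-deletion : ∀ {p q} → Adj (mkGraph N (pre ++ post)) p q → Adj (mkGraph N es) p q
  Adj-deletion = Adj-⊆ (λ e∈ → subst (_ ∈ˡ_) (sym es≡) (Any-resp-⊆ (deletion-⊑ pre post) e∈))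

  deleted-sole-edge : ∀ {p q} → mult (mkGraph N es) p q ≡ 1 → Joins p q e →
                      ¬ Adj (mkGraph N (pre ++ post)) p q
  deleted-sole-edge {p} {q} one joins = mult-zero⇒¬Adj (ℕ-suc-injective (begin
    suc (count (joins? p q) (pre ++ post)) ≡⟨ count-delete (joins? p q) pre post joins ⟨
    count (joins? p q) (pre ++ e ∷ post)   ≡⟨ cong (count (joins? p q)) es≡ ⟨
    count (joins? p q) es                  ≡⟨ one ⟩
    1                                      ∎))
    where open ≡-Reasoning

deletion-preserves-NoIsolated : ∀ {N} pre {e : Edge N} post → NoIsolated (mkGraph N (pre ++ e ∷ post)) →
                                (∀ {v} → Incident v e → degree (mkGraph N (pre ++ e ∷ post)) v ≢ 1) →
                                NoIsolated (mkGraph N (pre ++ post))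
deletion-preserves-NoIsolated pre {e} post noIsolated ends≢1 v = degree-pos⇒Adj (remaining (incident? v e))
  where
    remaining : Dec (Incident v e) → 0 < degree (mkGraph _ (pre ++ post)) v
    remaining (no ¬inc) = subst (0 <_) (count-delete-rejected (incident? v) pre post ¬inc)
                                (Adj⇒degree-pos (proj₂ (noIsolated v)))
    remaining (yes inc) = n≢0⇒n>0 λ none →
      ends≢1 inc (trans (count-delete (incident? v) pre post inc) (cong suc none))

-- The corona

data SplitView (m n : ℕ) : Fin (m + n) → Set where
  left  : (i : Fin m) → SplitView m n (i ↑ˡ n)
  right : (j : Fin n) → SplitView m n (m ↑ʳ j)

splitView : ∀ m n x → SplitView m n x
splitView m n x with splitAt m x in eq
... | inj₁ i = subst (SplitView m n) (splitAt⁻¹-↑ˡ eq) (left i)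
... | inj₂ j = subst (SplitView m n) (splitAt⁻¹-↑ʳ eq) (right j)

↑ˡ≢↑ʳ : ∀ {m n} (i : Fin m) (j : Fin n) → i ↑ˡ n ≢ m ↑ʳ j
↑ˡ≢↑ʳ {m} {n} i j eq with trans (sym (splitAt-↑ˡ m i n)) (trans (cong (splitAt m) eq) (splitAt-↑ʳ m n j))
... | ()

module _ (H : Graph) where

  private
    N = n H

  inner pendant : Vertex H → Vertex (corona H)
  inner v   = v ↑ˡ N
  pendant v = N ↑ʳ v

  lift : Edge N → Edge (N + N)
  lift (u , v) = inner u , inner v

  spoke : Vertex H → Edge (N + N)
  spoke v = inner v , pendant v

  inner≢pendant : ∀ {u v} → inner u ≢ pendant v
  inner≢pendant = ↑ˡ≢↑ʳ _ _

  inner-injective : ∀ {u v} → inner u ≡ inner v → u ≡ v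
  inner-injective = ↑ˡ-injective N _ _

  lift-injective : ∀ {e e′} → lift e ≡ lift e′ → e ≡ e′
  lift-injective eq = cong₂ _,_ (inner-injective (cong proj₁ eq)) (inner-injective (cong proj₂ eq))

  ∈-corona⁻ : ∀ {p q} → (p , q) ∈ˡ edges (corona H) →
              (∃₂ λ a b → (a , b) ∈ˡ edges H × p ≡ inner a × q ≡ inner b) ⊎
              (∃[ v ] p ≡ inner v × q ≡ pendant v)
  ∈-corona⁻ e∈ with ∈-++⁻ (map lift (edges H)) e∈
  ... | inj₁ e∈₁ with ∈-map⁻ lift e∈₁
  ...   | (a , b) , ab∈ , refl = inj₁ (a , b , ab∈ , refl , refl)
  ∈-corona⁻ e∈ | inj₂ e∈₂ with ∈-map⁻ spoke e∈₂
  ...   | v , _ , refl = inj₂ (v , refl , refl)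

  Adj-corona-pendant : ∀ {v w} → Adj (corona H) (pendant v) w → w ≡ inner v
  Adj-corona-pendant (inj₁ e∈) with ∈-corona⁻ e∈
  ... | inj₁ (_ , _ , _ , v′≡a , _) = ⊥-elim (inner≢pendant (sym v′≡a))
  ... | inj₂ (_ , v′≡x , _)         = ⊥-elim (inner≢pendant (sym v′≡x))
  Adj-corona-pendant (inj₂ e∈) with ∈-corona⁻ e∈
  ... | inj₁ (_ , _ , _ , _ , v′≡b) = ⊥-elim (inner≢pendant (sym v′≡b))
  ... | inj₂ (_ , w≡x , v′≡x′) rewrite ↑ʳ-injective N _ _ v′≡x′ = w≡x

  Adj-corona-inner : ∀ {v w} → Adj (corona H) (inner v) w →
                     (∃[ x ] w ≡ inner x × Adj H v x) ⊎ w ≡ pendant v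
  Adj-corona-inner (inj₁ e∈) with ∈-corona⁻ e∈
  ... | inj₁ (_ , b , ab∈ , v≡a , w≡b) rewrite inner-injective v≡a = inj₁ (b , w≡b , inj₁ ab∈)
  ... | inj₂ (_ , v≡x , w≡x′) rewrite inner-injective v≡x = inj₂ w≡x′
  Adj-corona-inner (inj₂ e∈) with ∈-corona⁻ e∈
  ... | inj₁ (a , _ , ab∈ , w≡a , v≡b) rewrite inner-injective v≡b = inj₁ (a , w≡a , inj₂ ab∈)
  ... | inj₂ (_ , _ , v≡x′) = ⊥-elim (inner≢pendant v≡x′)

  Adj-corona-lift : ∀ {u v} → Adj H u v → Adj (corona H) (inner u) (inner v)
  Adj-corona-lift = Sum.map (∈-++⁺ˡ ∘ ∈-map⁺ lift) (∈-++⁺ˡ ∘ ∈-map⁺ lift)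

  Adj-corona-spoke : ∀ v → Adj (corona H) (inner v) (pendant v)
  Adj-corona-spoke v = inj₁ (∈-++⁺ʳ (map lift (edges H)) (∈-map⁺ spoke (∈-allFin v)))

  mult-corona-lift : ∀ u v → mult (corona H) (inner u) (inner v) ≡ mult H u v
  mult-corona-lift u v = begin
    count J? (map lift (edges H) ++ map spoke (allFin N))
      ≡⟨ count-++ J? (map lift (edges H)) _ ⟩
    count J? (map lift (edges H)) + count J? (map spoke (allFin N))
      ≡⟨ cong₂ _+_ (trans (count-map J? lift (edges H)) (count-≐ _ (joins? u v) lift-joins (edges H)))
                   (trans (count-map J? spoke (allFin N)) (count-none _ (allFin N) λ _ → no-spoke)) ⟩
    mult H u v + 0
      ≡⟨ +-identityʳ _ ⟩
    mult H u v ∎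
    where
      open ≡-Reasoning
      J? : Decidable (Joins (inner u) (inner v))
      J? = joins? (inner u) (inner v)
      lift-joins : (Joins (inner u) (inner v) ∘ lift) ≐ Joins u v
      lift-joins = Sum.map lift-injective lift-injective , Sum.map (cong lift) (cong lift)
      no-spoke : ∀ {x} → ¬ Joins (inner u) (inner v) (spoke x)
      no-spoke (inj₁ eq) = inner≢pendant (sym (cong proj₂ eq))
      no-spoke (inj₂ eq) = inner≢pendant (sym (cong proj₂ eq))

  mult-corona-spoke : ∀ v → mult (corona H) (pendant v) (inner v) ≡ 1
  mult-corona-spoke v = begin
    count J? (map lift (edges H) ++ map spoke (allFin N))
      ≡⟨ count-++ J? (map lift (edges H)) _ ⟩
    count J? (map lift (edges H)) + count J? (map spoke (allFin N))
      ≡⟨ cong₂ _+_ (trans (count-map J? lift (edges H)) (count-none _ (edges H) λ _ → no-lift))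
                   (trans (count-map J? spoke (allFin N))
                          (count-tabulate-unique _ (λ x → x) (inj₂ refl) only-v)) ⟩
    1 ∎
    where
      open ≡-Reasoning
      J? : Decidable (Joins (pendant v) (inner v))
      J? = joins? (pendant v) (inner v)
      no-lift : ∀ {e} → ¬ Joins (pendant v) (inner v) (lift e)
      no-lift (inj₁ eq) = inner≢pendant (cong proj₁ eq)
      no-lift (inj₂ eq) = inner≢pendant (cong proj₂ eq)
      only-v : ∀ {x} → Joins (pendant v) (inner v) (spoke x) → x ≡ v
      only-v (inj₁ eq) = ⊥-elim (inner≢pendant (cong proj₁ eq))
      only-v (inj₂ eq) = inner-injective (cong proj₁ eq)

  corona-connected : Connected H → Connected (corona H)
  corona-connected connected x y =
    Reach-trans (to-base x) (Reach-trans (Reach-map inner Adj-corona-lift (connected (base x) (base y))) (from-base y))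
    where
      base : Vertex (corona H) → Vertex H
      base x with splitView N N x
      ... | left v  = v
      ... | right v = v
      to-base : ∀ x → Reach (corona H) x (inner (base x))
      to-base x with splitView N N x
      ... | left v  = here
      ... | right v = step (Adj-sym (Adj-corona-spoke v)) here
      from-base : ∀ x → Reach (corona H) (inner (base x)) x
      from-base x with splitView N N x
      ... | left v  = here
      ... | right v = step (Adj-corona-spoke v) here

  inners : Subset (N + N)
  inners = replicate N true ++ᵛ replicate N false

  inner∈inners : ∀ v → inner v ∈ inners
  inner∈inners v =
    lookup⇒[]= (inner v) inners (trans (lookup-++ˡ (replicate N true) _ v) (lookup-replicate v true))

  pendant∉inners : ∀ v → ¬ pendant v ∈ inners
  pendant∉inners v v′∈
    with trans (sym (trans (lookup-++ʳ (replicate N true) _ v) (lookup-replicate v false))) ([]=⇒lookup v′∈)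
  ... | ()

  corona-DTDP : NoIsolated H → DTDP (corona H)
  corona-DTDP noIsolated = ∁ inners , inners , (λ _ → x∈∁p⇒x∉p) , dominating , total
    where
      dominating : Dominating (corona H) (∁ inners)
      dominating x x∉D with splitView N N x
      ... | left v  = pendant v , x∉p⇒x∈∁p (pendant∉inners v) , Adj-corona-spoke v
      ... | right v = ⊥-elim (x∉D (x∉p⇒x∈∁p (pendant∉inners v)))
      total : TotalDominating (corona H) inners
      total x with splitView N N x
      ... | left v  = let w , adj = noIsolated v in inner w , inner∈inners w , Adj-corona-lift adj
      ... | right v = inner v , inner∈inners v , Adj-sym (Adj-corona-spoke v)

  spoke-deletion-¬DTDP : ∀ {pre v post} → edges (corona H) ≡ pre ++ spoke v ∷ post →
                         ¬ DTDP (mkGraph (N + N) (pre ++ post))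
  spoke-deletion-¬DTDP {v = v} eq = isolated-vertex⇒¬DTDP isolated
    where
      isolated : ∀ {w} → ¬ Adj _ (pendant v) w
      isolated adj with Adj-corona-pendant (Adj-deletion eq adj)
      ... | refl = deleted-sole-edge eq (mult-corona-spoke v) (inj₂ refl) adj

  leaf-deletion-¬DTDP : ∀ {l c pre e post} → Leaf H l c → Joins (inner l) (inner c) e →
                        edges (corona H) ≡ pre ++ e ∷ post → ¬ DTDP (mkGraph (N + N) (pre ++ post))
  leaf-deletion-¬DTDP {l} {c} leaf joins eq = isolated-edge⇒¬DTDP only-pendant only-inner
    where
      only-pendant : ∀ {w} → Adj _ (inner l) w → w ≡ pendant l
      only-pendant adj with Adj-corona-inner (Adj-deletion eq adj)
      ... | inj₂ w≡l′ = w≡l′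
      ... | inj₁ (x , refl , adjᴴ) with Leaf-unique-neighbour leaf adjᴴ
      ...   | refl = ⊥-elim (deleted-sole-edge eq (trans (mult-corona-lift l c) (proj₂ leaf)) joins adj)
      only-inner : ∀ {w} → Adj _ (pendant l) w → w ≡ inner l
      only-inner adj = Adj-corona-pendant (Adj-deletion eq adj)

  corona-deletion-¬DTDP : EveryEdgePendant H → ∀ {pre e post} → edges (corona H) ≡ pre ++ e ∷ post →
                          ¬ DTDP (mkGraph (N + N) (pre ++ post))
  corona-deletion-¬DTDP pendantEdges {pre} {p , q} {post} eq
    with ∈-corona⁻ (subst ((p , q) ∈ˡ_) (sym eq) (∈-++⁺ʳ pre (here refl)))
  ... | inj₂ (v , refl , refl) = spoke-deletion-¬DTDP eq
  ... | inj₁ (a , b , ab∈ , refl , refl) with pendantEdges (inj₁ ab∈)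
  ...   | inj₁ leaf = leaf-deletion-¬DTDP leaf (inj₁ refl) eq
  ...   | inj₂ leaf = leaf-deletion-¬DTDP leaf (inj₂ refl) eq

  EveryEdgePendant⇒NoProperSpanningDTDP : EveryEdgePendant H → NoProperSpanningDTDP (corona H)
  EveryEdgePendant⇒NoProperSpanningDTDP pendantEdges (mkGraph _ es′) (refl , es′⊑ , shorter) dtdp
    with shorter-sublist⇒deletion es′⊑ shorter
  ... | _ , _ , _ , eq , es′⊑⁻ = corona-deletion-¬DTDP pendantEdges eq (DTDP-⊆ (Any-resp-⊆ es′⊑⁻) dtdp)

minimal⇒edge-has-degree-one-end : ∀ H → NoIsolated H → NoProperSpanningDTDP (corona H) →
                                  ∀ {a b} → (a , b) ∈ˡ edges H → degree H a ≡ 1 ⊎ degree H b ≡ 1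
minimal⇒edge-has-degree-one-end (mkGraph N _) noIsolated minimal {a} {b} ab∈ with ∈-∃++ ab∈
... | pre , post , refl with degree (mkGraph N (pre ++ (a , b) ∷ post)) a ≟ℕ 1
                           | degree (mkGraph N (pre ++ (a , b) ∷ post)) b ≟ℕ 1
...   | yes a₁ | _      = inj₁ a₁
...   | no _   | yes b₁ = inj₂ b₁
...   | no a≢1 | no b≢1 =
  ⊥-elim (minimal (corona H⁻) (refl , map-deletion-⊏ (lift H) pre post (map (spoke H) (allFin N)))
                  (corona-DTDP H⁻ (deletion-preserves-NoIsolated pre post noIsolated ends≢1)))
  where
    H H⁻ : Graph
    H  = mkGraph N (pre ++ (a , b) ∷ post)
    H⁻ = mkGraph N (pre ++ post)
    ends≢1 : ∀ {v} → Incident v (a , b) → degree H v ≢ 1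
    ends≢1 (inj₁ refl) = a≢1
    ends≢1 (inj₂ refl) = b≢1

minimal⇒EveryEdgePendant : ∀ H → NoIsolated H → NoProperSpanningDTDP (corona H) → EveryEdgePendant H
minimal⇒EveryEdgePendant H noIsolated minimal adj@(inj₁ ab∈)
  with minimal⇒edge-has-degree-one-end H noIsolated minimal ab∈
... | inj₁ a₁ = inj₁ (degree-one⇒Leaf a₁ adj)
... | inj₂ b₁ = inj₂ (degree-one⇒Leaf b₁ (Adj-sym adj))
minimal⇒EveryEdgePendant H noIsolated minimal adj@(inj₂ ba∈)
  with minimal⇒edge-has-degree-one-end H noIsolated minimal ba∈
... | inj₁ b₁ = inj₂ (degree-one⇒Leaf b₁ (Adj-sym adj))
... | inj₂ a₁ = inj₁ (degree-one⇒Leaf a₁ adj)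

-- Stars and C₁

StarShaped : (G : Graph) → Vertex G → Set
StarShaped G c = mult G c c ≡ 0 × (∀ v → v ≢ c → Leaf G v c)

module _ {G : Graph} {c : Vertex G} (star : StarShaped G c) where

  centre-leaf-mult : ∀ {v} → v ≢ c → mult G c v ≡ 1
  centre-leaf-mult {v} v≢c = trans (mult-sym {G} c v) (proj₂ (proj₂ star v v≢c))

  leaf-leaf-mult : ∀ {u v} → u ≢ c → v ≢ c → mult G u v ≡ 0
  leaf-leaf-mult {u} {v} u≢c v≢c = proj₁ (proj₂ star u u≢c) v v≢c

  StarShaped⇒EveryEdgePendant : EveryEdgePendant G
  StarShaped⇒EveryEdgePendant {a} {b} adj with a ≟ᶠ c | b ≟ᶠ c
  ... | yes refl | yes refl = ⊥-elim (mult-zero⇒¬Adj (proj₁ star) adj)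
  ... | yes refl | no b≢c   = inj₂ (proj₂ star b b≢c)
  ... | no a≢c   | yes refl = inj₁ (proj₂ star a a≢c)
  ... | no a≢c   | no b≢c   = ⊥-elim (mult-zero⇒¬Adj (leaf-leaf-mult a≢c b≢c) adj)

StarShaped-≅ : ∀ {G G′ c c′} → StarShaped G c → StarShaped G′ c′ →
               (σ : Vertex G ↔ Vertex G′) → Inverse.to σ c ≡ c′ → Isomorphic G G′
StarShaped-≅ {G} {G′} {c} {c′} star star′ σ σc≡c′ = σ , preserves
  where
    open Inverse σ using (to)
    moved : ∀ {v} → v ≢ c → to v ≢ c′
    moved v≢c σv≡c′ = v≢c (Injection.injective (↔⇒↣ σ) (trans σv≡c′ (sym σc≡c′)))
    preserves : ∀ u v → mult G u v ≡ mult G′ (to u) (to v)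
    preserves u v with u ≟ᶠ c | v ≟ᶠ c
    ... | yes refl | yes refl rewrite σc≡c′ = trans (proj₁ star) (sym (proj₁ star′))
    ... | yes refl | no v≢c   rewrite σc≡c′ =
      trans (centre-leaf-mult {G} star v≢c) (sym (centre-leaf-mult {G′} star′ (moved v≢c)))
    ... | no u≢c   | yes refl rewrite σc≡c′ =
      trans (proj₂ (proj₂ star u u≢c)) (sym (proj₂ (proj₂ star′ (to u) (moved u≢c))))
    ... | no u≢c   | no v≢c   =
      trans (leaf-leaf-mult {G} star u≢c v≢c) (sym (leaf-leaf-mult {G′} star′ (moved u≢c) (moved v≢c)))

Star-StarShaped : ∀ k → StarShaped (Star k) zero
Star-StarShaped k = centre , leaves
  where
    centre : mult (Star k) zero zero ≡ 0
    centre = trans (count-map (joins? zero zero) (λ i → zero , suc i) (allFin k))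
                   (count-none _ (allFin k) λ _ → λ { (inj₁ ()) ; (inj₂ ()) })
    leaves : ∀ v → v ≢ zero → Leaf (Star k) v zero
    leaves zero    0≢0 = ⊥-elim (0≢0 refl)
    leaves (suc i) _   = elsewhere , one
      where
        elsewhere : ∀ x → x ≢ zero → mult (Star k) (suc i) x ≡ 0
        elsewhere zero    0≢0 = ⊥-elim (0≢0 refl)
        elsewhere (suc j) _   = trans (count-map (joins? (suc i) (suc j)) (λ i → zero , suc i) (allFin k))
                                      (count-none _ (allFin k) λ _ → λ { (inj₁ ()) ; (inj₂ ()) })
        one : mult (Star k) (suc i) zero ≡ 1
        one = trans (count-map (joins? (suc i) zero) (λ i → zero , suc i) (allFin k))
                    (count-tabulate-unique (joins? (suc i) zero ∘ λ i → zero , suc i) (λ x → x) (inj₂ refl)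
                                           λ { (inj₁ ()) ; (inj₂ refl) → refl })

transpose-first : ∀ {n} (i j : Fin n) → Inverse.to (transpose i j) i ≡ j
transpose-first i j with i ≟ᶠ i
... | yes _   = refl
... | no i≢i = ⊥-elim (i≢i refl)

StarShaped⇒≅Star : ∀ {K es c} → StarShaped (mkGraph (suc K) es) c → Isomorphic (mkGraph (suc K) es) (Star K)
StarShaped⇒≅Star {K} {es} {c} star =
  StarShaped-≅ {mkGraph (suc K) es} {Star K} star (Star-StarShaped K) (transpose c zero) (transpose-first c zero)

leaf⇒StarShaped : ∀ {G c l} → Connected G → EveryEdgePendant G → Leaf G l c → l ≢ c → StarShaped G c
leaf⇒StarShaped {G} {c} {l} connected pendantEdges leafₗ l≢c = loopless , leaves
  where
    c~l : Adj G c l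
    c~l = Adj-sym (Leaf⇒Adj leafₗ)
    loopless : mult G c c ≡ 0
    loopless with mult G c c ≟ℕ 0
    ... | yes none = none
    ... | no some  = ⊥-elim (l≢c (Leaf-unique-neighbour (reduce (pendantEdges loop)) c~l))
      where
        loop : Adj G c c
        loop = mult-pos⇒Adj (n≢0⇒n>0 some)
    CentreOrLeaf : Vertex G → Set
    CentreOrLeaf v = v ≡ c ⊎ Leaf G v c
    closed : ∀ {u w} → CentreOrLeaf u → Adj G u w → CentreOrLeaf w
    closed (inj₁ refl) adj with pendantEdges adj
    ... | inj₁ leaf-c = inj₂ (subst (λ x → Leaf G x c) (Leaf-unique-neighbour leaf-c c~l) leafₗ)
    ... | inj₂ leaf-w = inj₂ leaf-w
    closed (inj₂ leaf-u) adj = inj₁ (Leaf-unique-neighbour leaf-u adj)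
    leaves : ∀ v → v ≢ c → Leaf G v c
    leaves v v≢c with Reach-invariant CentreOrLeaf closed (inj₁ refl) (connected c v)
    ... | inj₁ v≡c = ⊥-elim (v≢c v≡c)
    ... | inj₂ leaf = leaf

single-looped-vertex⇒≅C₁ : ∀ {G c} → (∀ v → v ≡ c) → mult G c c ≡ 1 → Isomorphic G C₁
single-looped-vertex⇒≅C₁ {G} {c} only loop =
  mk↔ₛ′ (λ _ → zero) (λ _ → c) (λ { zero → refl }) (sym ∘ only) ,
  λ u v → trans (cong₂ (mult G) (only u) (only v)) loop

loop-leaf⇒≅C₁ : ∀ {G c} → Connected G → Leaf G c c → Isomorphic G C₁
loop-leaf⇒≅C₁ {G} {c} connected leaf =
  single-looped-vertex⇒≅C₁ {G} (λ v → Reach-invariant (_≡ c) closed refl (connected c v)) (proj₂ leaf)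
  where
    closed : ∀ {u w} → u ≡ c → Adj G u w → w ≡ c
    closed refl = Leaf-unique-neighbour leaf

C₁-EveryEdgePendant : EveryEdgePendant C₁
C₁-EveryEdgePendant {zero} {zero} _ = inj₁ ((λ { zero 0≢0 → ⊥-elim (0≢0 refl) }) , refl)

EveryEdgePendant-≅ : ∀ {G G′} → Isomorphic G G′ → EveryEdgePendant G′ → EveryEdgePendant G
EveryEdgePendant-≅ {G} {G′} (σ , preserves) pendantEdges′ {a} {b} adj = Sum.map pull pull (pendantEdges′ adj′)
  where
    open Inverse σ using (to)
    adj′ : Adj G′ (to a) (to b)
    adj′ = mult-pos⇒Adj (subst (0 <_) (preserves a b) (Adj⇒mult-pos adj))
    pull : ∀ {v u} → Leaf G′ (to v) (to u) → Leaf G v u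
    pull {v} {u} (elsewhere , one) =
      (λ x x≢u → trans (preserves v x) (elsewhere (to x) (x≢u ∘ Injection.injective (↔⇒↣ σ)))) ,
      trans (preserves v u) one

StarOrC₁ : Graph → Set
StarOrC₁ H = (∃[ k ] (1 ≤ k × Isomorphic H (Star k))) ⊎ Isomorphic H C₁

StarOrC₁⇒EveryEdgePendant : ∀ {H} → StarOrC₁ H → EveryEdgePendant H
StarOrC₁⇒EveryEdgePendant (inj₁ (k , _ , H≅Star)) =
  EveryEdgePendant-≅ H≅Star (StarShaped⇒EveryEdgePendant {Star k} (Star-StarShaped k))
StarOrC₁⇒EveryEdgePendant (inj₂ H≅C₁) = EveryEdgePendant-≅ H≅C₁ C₁-EveryEdgePendant

distinct⇒1≤ : ∀ {K} {i j : Fin (suc K)} → i ≢ j → 1 ≤ K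
distinct⇒1≤ {zero}  {zero} {zero} i≢j = ⊥-elim (i≢j refl)
distinct⇒1≤ {suc K} _ = s≤s z≤n

leaf⇒StarOrC₁ : ∀ {K es l c} → let H = mkGraph (suc K) es in
                Connected H → EveryEdgePendant H → Leaf H l c → StarOrC₁ H
leaf⇒StarOrC₁ {K} {es} {l} {c} connected pendantEdges leaf with l ≟ᶠ c
... | yes refl = inj₂ (loop-leaf⇒≅C₁ connected leaf)
... | no l≢c   = inj₁ (K , distinct⇒1≤ l≢c ,
                      StarShaped⇒≅Star {K} {es} (leaf⇒StarShaped {mkGraph (suc K) es} connected pendantEdges leaf l≢c))

EveryEdgePendant⇒StarOrC₁ : ∀ H → Connected H → 0 < length (edges H) → EveryEdgePendant H → StarOrC₁ H
EveryEdgePendant⇒StarOrC₁ (mkGraph zero    ((() , _) ∷ _)) _ _ _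
EveryEdgePendant⇒StarOrC₁ (mkGraph (suc K) (_ ∷ _)) connected _ pendantEdges
  with pendantEdges (inj₁ (here refl))
... | inj₁ leaf = leaf⇒StarOrC₁ connected pendantEdges leaf
... | inj₂ leaf = leaf⇒StarOrC₁ connected pendantEdges leaf

proposition2p6 : (H : Graph) → Connected H → 0 < length (edges H) →
    DTDP (corona H) ×
    (MinimalDTDP (corona H) ⇔ ((∃[ k ] (1 ≤ k × Isomorphic H (Star k))) ⊎ Isomorphic H C₁))
proposition2p6 H connected nonempty = corona-DTDP H noIsolated , mk⇔ forward backward
  where
    noIsolated : NoIsolated H
    noIsolated = connected⇒NoIsolated H connected nonempty
    forward : MinimalDTDP (corona H) → StarOrC₁ H
    forward (_ , _ , minimal) =
      EveryEdgePendant⇒StarOrC₁ H connected nonempty (minimal⇒EveryEdgePendant H noIsolated minimal)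
    backward : StarOrC₁ H → MinimalDTDP (corona H)
    backward starOrC₁ =
      corona-connected H connected , corona-DTDP H noIsolated ,
      EveryEdgePendant⇒NoProperSpanningDTDP H (StarOrC₁⇒EveryEdgePendant starOrC₁)
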